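{- For the pawns game described in the context, for all integers $m\geq 0$ the Nim-value $\epsilon(m)$ of the component $[m]$ satisfies $\epsilon(m)=0$ if $m\equiv 0,2,3,6,$ or $9\pmod{10}$, and $\epsilon(m)=1$ otherwise. Moreover, a move to $[:\!m]$ is loony if and only if $m=5k\pm1$ for some integer $k$.
   Context: The pawns game. The board has $3$ rows and $n$ files. Initially White pawns occupy some squares of the bottom row, and Black pawns occupy the squares of the top row in exactly the same files. Pawns move as chess pawns (White upward, Black downward): one square straight forward onto an empty square, or a capture of an opposing pawn one square diagonally forward; no double step, no en passant; captures are optional. A player whose pawn reaches the opposite row wins immediately; otherwise the last player to move wins. Moves conceding an immediate win are assumed never played. A file is initial if it contains its unmoved White pawn in the bottom row and unmoved Black pawn in the top row. Empty files and files where no move is possible split the board into independent components; a position is the sum of its components. $[m]$ is a component of $m$ consecutive initial files. Entailing components (the opponent must reply there with a listed move): $[:\!m]$, $[:\!.]$, $[m\!:\!m']$, $[.\!:\!m]$, with conventions $[0]=[:\!0]=[0\!:\!0]=0$, $[.\!:\!0]=[:\!.]$, $[m\!:\!0]=[0\!:\!m]=[:\!m]$. The moves are: from $[m]$ either side may move to $[m_1\!:\!m_2]$ for any $m_1,m_2\geq0$ with $m_1+m_2=m-1$; for $m>0$, $[:\!m]$ entails a move to $[:\!.]+[m-1]$ or $[:\!(m-1)]$; $[:\!.]$ entails a move to $0$; for $m,m'>0$, $[m\!:\!m']$ entails a move to $[m-1]+[.\!:\!m']$ or $[m'-1]+[.\!:\!m]$; for $m>0$, $[.\!:\!m]$ entails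 a move to $[:\!m]$. (Physically, $[:\!m]$ is a pawn just moved to the middle row at the end of a block of $m$ initial files, attacked and defended once each.) A move is loony if, whatever the other components are, the opponent has a winning reply. Excluding loony moves and moves conceding immediate wins, each $[m]$ is equivalent (in every sum) to a Nim-heap; $\epsilon(m)$ denotes the size of that Nim-heap. -}

module Defs where

open import Data.Nat using (ℕ; zero; suc; _+_; _<_; _%_)
open import Data.List using (List; []; _∷_; _++_)
open import Data.Maybe using (Maybe; just; nothing)
open import Data.Integer as ℤ using (ℤ)
open import Data.Product using (∃-syntax)
open import Data.Sum using (_⊎_)
open import Relation.Binary.PropositionalEquality using (_≡_)

-- Entailing components of the pawns game (arguments are the sizes m, m').
--   colon m      = [: m]     (meaningful for m > 0; [:0] = 0)
--   colonDot     = [: .]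
--   pair m m'    = [m : m']  (meaningful for m, m' > 0)
--   dotColon m   = [. : m]   (meaningful for m > 0; [.:0] = [:.])
-- Only well-formed ones are ever built, via the smart constructors below,
-- which implement the conventions of the paper.

data Ent : Set where
  colon    : ℕ → Ent
  colonDot : Ent
  pair     : ℕ → ℕ → Ent
  dotColon : ℕ → Ent

mkColon : ℕ → Maybe Ent
mkColon zero    = nothing
mkColon (suc m) = just (colon (suc m))

mkPair : ℕ → ℕ → Maybe Ent
mkPair zero    m'       = mkColon m'
mkPair (suc m) zero     = mkColon (suc m)
mkPair (suc m) (suc m') = just (pair (suc m) (suc m'))

mkDotColon : ℕ → Maybe Ent
mkDotColon zero    = just colonDot
mkDotColon (suc m) = just (dotColon (suc m))

-- A position: a sum of blocks [m] (list of their sizes), Nim-heaps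
-- (list of their sizes, used only for comparison with Nim), and at most
-- one entailing component (which the player to move must answer).

record Pos : Set where
  constructor pos
  field
    blocks : List ℕ
    heaps  : List ℕ
    ent    : Maybe Ent

data Move : Pos → Pos → Set where
  split : ∀ xs ys hs m₁ m₂ →
    Move (pos (xs ++ suc (m₁ + m₂) ∷ ys) hs nothing)
         (pos (xs ++ ys) hs (mkPair m₁ m₂))
  nim : ∀ bs xs ys k j → j < k →
    Move (pos bs (xs ++ k ∷ ys) nothing)
         (pos bs (xs ++ j ∷ ys) nothing)
  colon-dot : ∀ bs hs m →
    Move (pos bs hs (just (colon (suc m))))
         (pos (m ∷ bs) hs (just colonDot))
  colon-shrink : ∀ bs hs m →
    Move (pos bs hs (just (colon (suc m))))
         (pos bs hs (mkColon m))
  colonDot-end : ∀ bs hs →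
    Move (pos bs hs (just colonDot))
         (pos bs hs nothing)
  pair-left : ∀ bs hs m m' →
    Move (pos bs hs (just (pair (suc m) (suc m'))))
         (pos (m ∷ bs) hs (mkDotColon (suc m')))
  pair-right : ∀ bs hs m m' →
    Move (pos bs hs (just (pair (suc m) (suc m'))))
         (pos (m' ∷ bs) hs (mkDotColon (suc m)))
  dotColon-move : ∀ bs hs m →
    Move (pos bs hs (just (dotColon (suc m))))
         (pos bs hs (mkColon (suc m)))

-- Normal play (last player to move wins): the player to move has a
-- winning strategy (Win) / the player to move loses (Lose).
data Win  : Pos → Set
data Lose : Pos → Set

data Win where
  win : ∀ {p q} → Move p q → Lose q → Win p

data Lose where
  lose : ∀ {p} → (∀ q → Move p q → Win q) → Lose p

-- A move to [:m] is loony: whatever the other components G are, the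
-- opponent (now to move, forced to answer in [:m]) has a winning reply.
Loony : ℕ → Set
Loony m = ∀ (G : List ℕ) → Win (pos G [] (mkColon m))

εtable : ℕ → ℕ
εtable 0 = 0
εtable 2 = 0
εtable 3 = 0
εtable 6 = 0
εtable 9 = 0
εtable _ = 1

ε : ℕ → ℕ
ε m = εtable (m % 10)

FiveKPM1 : ℕ → Set
FiveKPM1 m = ∃[ k ] ((ℤ.+ m ≡ ℤ.+ 5 ℤ.* k ℤ.+ ℤ.+ 1) ⊎ (ℤ.+ m ≡ ℤ.+ 5 ℤ.* k ℤ.- ℤ.+ 1))

{-# OPTIONS --safe #-}
-- With heaps of size at most 1 the Nim-value of a position is a single bit: the xor of ε over its
-- blocks and of its heaps. An entailing component is a short forced line of play, so its effect is
-- a Boolean function of that bit (entValue), read off from the entailed moves. The claim is then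
-- the usual P-position check: from value 0 every move leads to value 1 (in particular no split of
-- [m] answers a heap *ε(m)), and from value 1 some move leads to value 0. Both ε and colonValue are
-- eventually periodic (preperiod 2, period 10), so each infinite family of cases reduces to a
-- finite table that Agda evaluates. A move to [:m] is loony iff [:m] wins against a remainder of
-- either value, which by the same periodicity happens exactly when m ≡ ±1 (mod 5).
module Submission where

open import Defs
open import Algebra.Bundles using (CommutativeRing)
import Algebra.Properties.CommutativeSemigroup as CommutativeSemigroupProperties
open import Data.Bool using (Bool; true; false; not; _∧_; _∨_; _xor_)
open import Data.Bool.Properties
  using (xor-assoc; ∨-comm; ∨-conicalˡ; ∨-conicalʳ; not-involutive; xor-∧-commutativeRing)
  renaming (_≟_ to _≟ᵇ_)
open import Data.Fin using (Fin; toℕ; fromℕ<)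
open import Data.Fin.Properties using (all?; toℕ-fromℕ<)
open import Data.Integer as ℤ using (-[1+_]; _⊖_)
import Data.Integer.Properties as ℤ
open import Data.List using (List; []; _∷_; _++_; foldr)
open import Data.List.Relation.Binary.Permutation.Propositional.Properties using (shift)
open import Data.List.Relation.Unary.All using (All; []; _∷_)
open import Data.List.Relation.Unary.All.Properties using (++⁺; ++⁻)
open import Data.Maybe using (Maybe; just; nothing)
open import Data.Nat
  using ( ℕ; zero; suc; _+_; _*_; _∸_; _≤_; _<_; _≡ᵇ_; _%_; _/_; z≤n; s≤s
        ; NonZero; >-nonZero⁻¹; _<?_; _≤?_)
open import Data.Nat.DivMod using (m≡m%n+[m/n]*n; [m+n]%n≡m%n; [m+kn]%n≡m%n)
open import Data.Nat.Induction using (<-rec; <-wellFounded)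
open import Data.Nat.ListAction using (sum)
open import Data.Nat.ListAction.Properties using (sum-↭)
open import Data.Nat.Properties
open import Data.Nat.Tactic.RingSolver using (solve-∀)
open import Data.Product using (_×_; _,_; proj₁; proj₂; ∃-syntax)
open import Data.Sum using (_⊎_; inj₁; inj₂)
open import Function.Bundles using (_⇔_; mk⇔; Equivalence)
import Function.Properties.Equivalence as ⇔
open import Induction.WellFounded using (Acc; acc)
open import Relation.Binary.PropositionalEquality
open import Relation.Nullary using (¬_; yes; no; contradiction)
open import Relation.Nullary.Decidable using (from-yes)

open Equivalence using (to; from)

module xor =
  CommutativeSemigroupProperties (CommutativeRing.+-commutativeSemigroup xor-∧-commutativeRing)
module ℕ+ = CommutativeSemigroupProperties +-commutativeSemigroup

periodic-induction : ∀ {ℓ} {P : ℕ → Set ℓ} p q .{{_ : NonZero q}} →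
                     (∀ (i : Fin (p + q)) → P (toℕ i)) →
                     (∀ k → P (p + k) → P (p + q + k)) →
                     ∀ n → P n
periodic-induction {P = P} p q base step = <-rec P go
  where
  go : ∀ n → (∀ {m} → m < n → P m) → P n
  go n rec with n <? p + q
  ... | yes n<p+q = subst P (toℕ-fromℕ< n<p+q) (base (fromℕ< n<p+q))
  ... | no  n≮p+q = subst P n≡p+q+k (step k (rec p+k<n))
    where
    k : ℕ
    k = n ∸ (p + q)
    n≡p+q+k : p + q + k ≡ n
    n≡p+q+k = m+[n∸m]≡n (≮⇒≥ n≮p+q)
    p+k<n : p + k < n
    p+k<n = <-≤-trans (+-monoˡ-< k (m<m+n p (>-nonZero⁻¹ q))) (≤-reflexive n≡p+q+k)

not-flip : ∀ {a b} → not a ≡ b → a ≡ not b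
not-flip {a} eq = trans (sym (not-involutive a)) (cong not eq)

xor≡false⇒≡ : ∀ a {b} → a xor b ≡ false → a ≡ b
xor≡false⇒≡ false eq = sym eq
xor≡false⇒≡ true  eq = sym (not-flip eq)

xor≡true : ∀ a {b} → a xor b ≡ true → a ≡ true ⊎ b ≡ true
xor≡true true  _  = inj₁ refl
xor≡true false eq = inj₂ eq

∨≡true : ∀ a {b} → a ∨ b ≡ true → a ≡ true ⊎ b ≡ true
∨≡true true  _  = inj₁ refl
∨≡true false eq = inj₂ eq

∧≡true : ∀ a {b} → a ∧ b ≡ true → a ≡ true × b ≡ true
∧≡true true eq = refl , eq

parity : {A : Set} → (A → Bool) → List A → Bool
parity f = foldr (λ x b → f x xor b) false

parity-middle : ∀ {A : Set} (f : A → Bool) xs x ys →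
                parity f (xs ++ x ∷ ys) ≡ f x xor parity f (xs ++ ys)
parity-middle f []       x ys = refl
parity-middle f (z ∷ xs) x ys =
  trans (cong (f z xor_) (parity-middle f xs x ys)) (xor.x∙yz≈y∙xz (f z) (f x) _)

parity-true : ∀ {A : Set} (f : A → Bool) xs → parity f xs ≡ true →
              ∃[ ys ] ∃[ x ] ∃[ zs ] xs ≡ ys ++ x ∷ zs × f x ≡ true
parity-true f []       ()
parity-true f (x ∷ xs) p with f x in fx
... | true  = [] , x , xs , refl , fx
... | false with parity-true f xs p
...   | ys , y , zs , refl , fy = x ∷ ys , y , zs , refl , fy

sum-middle : ∀ xs x ys → sum (xs ++ x ∷ ys) ≡ x + sum (xs ++ ys)
sum-middle xs x ys = sum-↭ (shift x xs ys)

lose⇒¬win : ∀ {p} → Lose p → ¬ Win p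
lose⇒¬win (lose f) (win mv l) = lose⇒¬win l (f _ mv)

module Outcome {Inv : Pos → Set} {val : Pos → Bool} {measure : Pos → ℕ}
  (measure-decreasing : ∀ {p q} → Move p q → measure q < measure p)
  (Inv-preserved : ∀ {p q} → Inv p → Move p q → Inv q)
  (zero⇒moves-to-nonzero : ∀ {p q} → Inv p → val p ≡ false → Move p q → val q ≡ true)
  (nonzero⇒zero-reachable : ∀ {p} → Inv p → val p ≡ true → ∃[ q ] Move p q × val q ≡ false)
  where

  Decided : Pos → Set
  Decided p = (val p ≡ true → Win p) × (val p ≡ false → Lose p)

  decided : ∀ p → Acc _<_ (measure p) → Inv p → Decided p
  decided p (acc rs) i = winning , losing
    where
    next : ∀ {q} → Move p q → Decided q
    next {q} mv = decided q (rs (measure-decreasing mv)) (Inv-preserved i mv)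
    winning : val p ≡ true → Win p
    winning v with nonzero⇒zero-reachable i v
    ... | q , mv , z = win mv (proj₂ (next mv) z)
    losing : val p ≡ false → Lose p
    losing z = lose λ q mv → proj₁ (next mv) (zero⇒moves-to-nonzero i z mv)

  win⇔val : ∀ p → Inv p → Win p ⇔ val p ≡ true
  win⇔val p i = mk⇔ to-val (proj₁ p-decided)
    where
    p-decided : Decided p
    p-decided = decided p (<-wellFounded (measure p)) i
    to-val : Win p → val p ≡ true
    to-val w with val p in eq
    ... | true  = refl
    ... | false = contradiction w (lose⇒¬win (proj₂ p-decided eq))

bit : ℕ → Bool
bit h = h ≡ᵇ 1

εᵇ : ℕ → Bool
εᵇ m = bit (ε m)

ε-periodic : ∀ n → ε (10 + n) ≡ ε n
ε-periodic n = cong εtable (trans (cong (_% 10) (+-comm 10 n)) ([m+n]%n≡m%n n 10))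

εᵇ-periodic : ∀ n → εᵇ (10 + n) ≡ εᵇ n
εᵇ-periodic n = cong bit (ε-periodic n)

εtable≤1 : ∀ r → εtable r ≤ 1
εtable≤1 =
  periodic-induction 0 10 (from-yes (all? λ (i : Fin 10) → εtable (toℕ i) ≤? 1)) (λ _ _ → ≤-refl)

ε≤1 : ∀ m → ε m ≤ 1
ε≤1 m = εtable≤1 (m % 10)

-- entValue x y is true iff the player to move wins x + G for every G of Nim-value y;
-- colonValue m y is the same for [:m].
colonValue : ℕ → Bool → Bool
colonValue zero    y = y
colonValue (suc m) y = (εᵇ m xor y) ∨ not (colonValue m y)

entValue : Maybe Ent → Bool → Bool
entValue nothing                         y = y
entValue (just (colon zero))             y = false
entValue (just (colon (suc m)))          y = colonValue (suc m) y
entValue (just colonDot)                 y = not y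
entValue (just (pair (suc m) (suc m')))  y =
  colonValue (suc m') (εᵇ m xor y) ∨ colonValue (suc m) (εᵇ m' xor y)
entValue (just (pair _ _))               y = false
entValue (just (dotColon zero))          y = false
entValue (just (dotColon (suc m)))       y = not (colonValue (suc m) y)

entValue-mkColon : ∀ m y → entValue (mkColon m) y ≡ colonValue m y
entValue-mkColon zero    y = refl
entValue-mkColon (suc m) y = refl

entValue-mkPair-comm : ∀ m₁ m₂ y → entValue (mkPair m₁ m₂) y ≡ entValue (mkPair m₂ m₁) y
entValue-mkPair-comm zero     zero     y = refl
entValue-mkPair-comm zero     (suc m₂) y = refl
entValue-mkPair-comm (suc m₁) zero     y = refl
entValue-mkPair-comm (suc m₁) (suc m₂) y = ∨-comm (colonValue (suc m₂) (εᵇ m₁ xor y)) _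

colonValue-periodic : ∀ k y → colonValue (12 + k) y ≡ colonValue (2 + k) y
colonValue-periodic zero    false = refl
colonValue-periodic zero    true  = refl
colonValue-periodic (suc k) y =
  cong₂ (λ e c → (e xor y) ∨ not c) (εᵇ-periodic (2 + k)) (colonValue-periodic k y)

entValue-mkPair-periodic : ∀ k m y → entValue (mkPair (12 + k) m) y ≡ entValue (mkPair (2 + k) m) y
entValue-mkPair-periodic k zero    y = colonValue-periodic k y
entValue-mkPair-periodic k (suc m) y =
  cong₂ (λ e c → colonValue (suc m) (e xor y) ∨ c)
        (εᵇ-periodic (1 + k)) (colonValue-periodic k (εᵇ m xor y))

splitValue : ℕ → ℕ → Bool
splitValue m₁ m₂ = entValue (mkPair m₁ m₂) (εᵇ (suc (m₁ + m₂)))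

splitValue-comm : ∀ m₁ m₂ → splitValue m₁ m₂ ≡ splitValue m₂ m₁
splitValue-comm m₁ m₂ = trans (entValue-mkPair-comm m₁ m₂ _)
  (cong (λ n → entValue (mkPair m₂ m₁) (εᵇ (suc n))) (+-comm m₁ m₂))

splitValue-periodic : ∀ k m → splitValue (12 + k) m ≡ splitValue (2 + k) m
splitValue-periodic k m =
  trans (cong (entValue (mkPair (12 + k) m)) (εᵇ-periodic (3 + k + m))) (entValue-mkPair-periodic k m _)

splitValue≡true : ∀ m₁ m₂ → splitValue m₁ m₂ ≡ true
splitValue≡true =
  periodic-induction 2 10 small (λ k ih m₂ → trans (splitValue-periodic k m₂) (ih m₂))
  where
  table : ∀ (i j : Fin 12) → splitValue (toℕ i) (toℕ j) ≡ true
  table = from-yes (all? λ (i : Fin 12) → all? λ (j : Fin 12) →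
                      splitValue (toℕ i) (toℕ j) ≟ᵇ true)
  small : ∀ (j : Fin 12) m₁ → splitValue (toℕ j) m₁ ≡ true
  small j m₁ = trans (splitValue-comm (toℕ j) m₁)
    (periodic-induction 2 10 (λ i → table i j) (λ k → trans (splitValue-periodic k (toℕ j))) m₁)

HasZeroSplit : ℕ → Set
HasZeroSplit b =
  ∃[ m₁ ] ∃[ m₂ ] suc (m₁ + m₂) ≡ b × entValue (mkPair m₁ m₂) false ≡ false

-- The left part is kept ≥ 2 so that adding the period 10 to it preserves the value.
zero-split-≥2 : ∀ k → εᵇ (2 + k) ≡ true →
                ∃[ c ] ∃[ m₂ ] suc (2 + c + m₂) ≡ 2 + k
                             × entValue (mkPair (2 + c) m₂) false ≡ false
zero-split-≥2 0 ()
zero-split-≥2 1 ()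
zero-split-≥2 2 _ = 1 , 0 , refl , refl
zero-split-≥2 3 _ = 0 , 2 , refl , refl
zero-split-≥2 4 ()
zero-split-≥2 5 _ = 1 , 3 , refl , refl
zero-split-≥2 6 _ = 5 , 0 , refl , refl
zero-split-≥2 7 ()
zero-split-≥2 8 ()
zero-split-≥2 9 _ = 8 , 0 , refl , refl
zero-split-≥2 (suc (suc (suc (suc (suc (suc (suc (suc (suc (suc k)))))))))) εb
  with zero-split-≥2 k (trans (sym (εᵇ-periodic (2 + k))) εb)
... | c , m₂ , eq , z = 10 + c , m₂ , cong (10 +_) eq , trans (entValue-mkPair-periodic c m₂ false) z

zero-split : ∀ b → εᵇ b ≡ true → HasZeroSplit b
zero-split 0             ()
zero-split 1             _  = 0 , 0 , refl , refl
zero-split (suc (suc k)) εb with zero-split-≥2 k εb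
... | c , m₂ , eq , z = 2 + c , m₂ , eq , z

restValue : List ℕ → List ℕ → Bool
restValue B H = parity εᵇ B xor parity bit H

value : Pos → Bool
value (pos B H x) = entValue x (restValue B H)

restValue-block : ∀ xs b ys H → restValue (xs ++ b ∷ ys) H ≡ εᵇ b xor restValue (xs ++ ys) H
restValue-block xs b ys H =
  trans (cong (_xor parity bit H) (parity-middle εᵇ xs b ys)) (xor-assoc (εᵇ b) _ _)

restValue-∷ : ∀ b B H → restValue (b ∷ B) H ≡ εᵇ b xor restValue B H
restValue-∷ = restValue-block []

restValue-heap : ∀ B xs h ys → restValue B (xs ++ h ∷ ys) ≡ bit h xor restValue B (xs ++ ys)
restValue-heap B xs h ys =
  trans (cong (parity εᵇ B xor_) (parity-middle bit xs h ys))
        (xor.x∙yz≈y∙xz (parity εᵇ B) (bit h) _)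

restValue-block≡heap : ∀ m G → restValue (m ∷ G) [] ≡ restValue G (ε m ∷ [])
restValue-block≡heap m G =
  trans (xor-assoc (εᵇ m) _ false) (xor.x∙yz≈y∙xz (εᵇ m) (parity εᵇ G) false)

-- Blocks weigh double so that the entailed move [:m] → [:.] + [m-1] still decreases the size.
entSize : Maybe Ent → ℕ
entSize nothing              = 0
entSize (just (colon m))     = 2 * m
entSize (just colonDot)      = 1
entSize (just (pair m m'))   = 2 * (m + m')
entSize (just (dotColon m))  = suc (2 * m)

weight : List ℕ → List ℕ → ℕ
weight B H = 2 * sum B + sum H

size : Pos → ℕ
size (pos B H x) = entSize x + weight B H

entSize-mkColon : ∀ m → entSize (mkColon m) ≡ 2 * m
entSize-mkColon zero    = refl
entSize-mkColon (suc m) = refl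

entSize-mkPair : ∀ m₁ m₂ → entSize (mkPair m₁ m₂) ≡ 2 * (m₁ + m₂)
entSize-mkPair zero     m₂       = entSize-mkColon m₂
entSize-mkPair (suc m₁) zero     = cong (2 *_) (sym (+-identityʳ (suc m₁)))
entSize-mkPair (suc m₁) (suc m₂) = refl

weight-block : ∀ xs b ys H → weight (xs ++ b ∷ ys) H ≡ 2 * b + weight (xs ++ ys) H
weight-block xs b ys H = begin
  2 * sum (xs ++ b ∷ ys) + sum H     ≡⟨ cong (λ s → 2 * s + sum H) (sum-middle xs b ys) ⟩
  2 * (b + sum (xs ++ ys)) + sum H   ≡⟨ cong (_+ sum H) (*-distribˡ-+ 2 b _) ⟩
  2 * b + 2 * sum (xs ++ ys) + sum H ≡⟨ +-assoc (2 * b) _ _ ⟩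
  2 * b + weight (xs ++ ys) H        ∎
  where open ≡-Reasoning

weight-heap : ∀ B xs h ys → weight B (xs ++ h ∷ ys) ≡ h + weight B (xs ++ ys)
weight-heap B xs h ys =
  trans (cong (2 * sum B +_) (sum-middle xs h ys)) (ℕ+.x∙yz≈y∙xz (2 * sum B) h _)

size-add-block : ∀ b B H x x' → entSize x' + 2 * b < entSize x →
                 size (pos (b ∷ B) H x') < size (pos B H x)
size-add-block b B H x x' lt = begin-strict
  entSize x' + weight (b ∷ B) H     ≡⟨ cong (entSize x' +_) (weight-block [] b B H) ⟩
  entSize x' + (2 * b + weight B H) ≡⟨ +-assoc (entSize x') _ _ ⟨
  entSize x' + 2 * b + weight B H   <⟨ +-monoˡ-< (weight B H) lt ⟩
  entSize x + weight B H            ∎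
  where open ≤-Reasoning

pair-move-weight : ∀ a b → suc (suc (2 * suc b) + 2 * a) ≡ 2 * (suc a + suc b)
pair-move-weight = solve-∀

size-decreasing : ∀ {p q} → Move p q → size q < size p
size-decreasing (split xs ys H m₁ m₂) = begin-strict
  entSize (mkPair m₁ m₂) + weight (xs ++ ys) H ≡⟨ cong (_+ _) (entSize-mkPair m₁ m₂) ⟩
  2 * (m₁ + m₂) + weight (xs ++ ys) H          <⟨ +-monoˡ-< _ (*-monoʳ-< 2 (n<1+n (m₁ + m₂))) ⟩
  2 * suc (m₁ + m₂) + weight (xs ++ ys) H      ≡⟨ weight-block xs _ ys H ⟨
  weight (xs ++ suc (m₁ + m₂) ∷ ys) H          ∎
  where open ≤-Reasoning
size-decreasing (nim B xs ys k j j<k) =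
  subst₂ _<_ (sym (weight-heap B xs j ys)) (sym (weight-heap B xs k ys))
    (+-monoˡ-< (weight B (xs ++ ys)) j<k)
size-decreasing (colon-dot B H m) =
  size-add-block m B H (just (colon (suc m))) (just colonDot) (≤-reflexive (sym (*-suc 2 m)))
size-decreasing (colon-shrink B H m) =
  +-monoˡ-< (weight B H) (subst (_< 2 * suc m) (sym (entSize-mkColon m)) (*-monoʳ-< 2 (n<1+n m)))
size-decreasing (colonDot-end B H) = n<1+n (weight B H)
size-decreasing (pair-left B H m m') =
  size-add-block m B H (just (pair (suc m) (suc m'))) (just (dotColon (suc m')))
    (≤-reflexive (pair-move-weight m m'))
size-decreasing (pair-right B H m m') =
  size-add-block m' B H (just (pair (suc m) (suc m'))) (just (dotColon (suc m)))
    (≤-reflexive (trans (pair-move-weight m' m) (cong (2 *_) (+-comm (suc m') (suc m)))))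
size-decreasing (dotColon-move B H m) = +-monoˡ-< (weight B H) (n<1+n (2 * suc m))

SmallHeaps : Pos → Set
SmallHeaps p = All (_≤ 1) (Pos.heaps p)

heap-≤1 : ∀ {xs h ys} → All (_≤ 1) (xs ++ h ∷ ys) → h ≤ 1
heap-≤1 {xs} small with ++⁻ xs small
... | _ , h≤1 ∷ _ = h≤1

SmallHeaps-preserved : ∀ {p q} → SmallHeaps p → Move p q → SmallHeaps q
SmallHeaps-preserved small (nim B xs ys k j j<k) with ++⁻ xs small
... | left , k≤1 ∷ right = ++⁺ left (≤-trans (<⇒≤ j<k) k≤1 ∷ right)
SmallHeaps-preserved small (split _ _ _ _ _)     = small
SmallHeaps-preserved small (colon-dot _ _ _)     = small
SmallHeaps-preserved small (colon-shrink _ _ _)  = small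
SmallHeaps-preserved small (colonDot-end _ _)    = small
SmallHeaps-preserved small (pair-left _ _ _ _)   = small
SmallHeaps-preserved small (pair-right _ _ _ _)  = small
SmallHeaps-preserved small (dotColon-move _ _ _) = small

bit≡true⇒1 : ∀ {h} → h ≤ 1 → bit h ≡ true → h ≡ 1
bit≡true⇒1 z≤n       ()
bit≡true⇒1 (s≤s z≤n) _ = refl

small-nim-move : ∀ {k j} → k ≤ 1 → j < k → k ≡ 1 × j ≡ 0
small-nim-move (s≤s z≤n) (s≤s z≤n) = refl , refl

zero⇒moves-to-nonzero : ∀ {p q} → SmallHeaps p → value p ≡ false → Move p q → value q ≡ true
zero⇒moves-to-nonzero _ z (split xs ys H m₁ m₂) =
  subst (λ y → entValue (mkPair m₁ m₂) y ≡ true)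
        (xor≡false⇒≡ (εᵇ (suc (m₁ + m₂)))
                      (trans (sym (restValue-block xs (suc (m₁ + m₂)) ys H)) z))
        (splitValue≡true m₁ m₂)
zero⇒moves-to-nonzero small z (nim B xs ys k j j<k) with small-nim-move (heap-≤1 small) j<k
... | refl , refl =
  trans (restValue-heap B xs 0 ys) (not-flip (trans (sym (restValue-heap B xs 1 ys)) z))
zero⇒moves-to-nonzero _ z (colon-dot B H m) =
  cong not (trans (restValue-∷ m B H) (∨-conicalˡ _ _ z))
zero⇒moves-to-nonzero _ z (colon-shrink B H m) =
  trans (entValue-mkColon m _) (not-flip (∨-conicalʳ _ _ z))
zero⇒moves-to-nonzero _ z (colonDot-end B H) = not-flip z
zero⇒moves-to-nonzero _ z (pair-left B H m m') =
  cong not (trans (cong (colonValue (suc m')) (restValue-∷ m B H)) (∨-conicalˡ _ _ z))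
zero⇒moves-to-nonzero _ z (pair-right B H m m') =
  cong not (trans (cong (colonValue (suc m)) (restValue-∷ m' B H))
                  (∨-conicalʳ (colonValue (suc m') _) _ z))
zero⇒moves-to-nonzero _ z (dotColon-move B H m) = not-flip z

nonzero⇒zero-reachable : ∀ {p} → SmallHeaps p → value p ≡ true →
                         ∃[ q ] Move p q × value q ≡ false
nonzero⇒zero-reachable {pos B H nothing} small v with xor≡true (parity εᵇ B) v
... | inj₁ odd-blocks with parity-true εᵇ B odd-blocks
...   | xs , b , ys , refl , εb with zero-split b εb
...     | m₁ , m₂ , refl , z =
  _ , split xs ys H m₁ m₂ , subst (λ y → entValue (mkPair m₁ m₂) y ≡ false) (sym rest) z
  where
  rest : restValue (xs ++ ys) H ≡ false
  rest = not-flip (trans (cong (_xor restValue (xs ++ ys) H) (sym εb))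
                         (trans (sym (restValue-block xs b ys H)) v))
nonzero⇒zero-reachable {pos B H nothing} small v | inj₂ odd-heaps with parity-true bit H odd-heaps
... | xs , h , ys , refl , bh with bit≡true⇒1 (heap-≤1 small) bh
...   | refl = _ , nim B xs ys 1 0 (s≤s z≤n) ,
               trans (restValue-heap B xs 0 ys) (not-flip (trans (sym (restValue-heap B xs 1 ys)) v))
nonzero⇒zero-reachable {pos B H (just (colon (suc m)))} _ v with ∨≡true (εᵇ m xor restValue B H) v
... | inj₁ d = _ , colon-dot B H m , cong not (trans (restValue-∷ m B H) d)
... | inj₂ s = _ , colon-shrink B H m , trans (entValue-mkColon m _) (not-flip s)
nonzero⇒zero-reachable {pos B H (just colonDot)} _ v = _ , colonDot-end B H , not-flip v
nonzero⇒zero-reachable {pos B H (just (pair (suc m) (suc m')))} _ v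
  with ∨≡true (colonValue (suc m') (εᵇ m xor restValue B H)) v
... | inj₁ l = _ , pair-left B H m m' ,
                 cong not (trans (cong (colonValue (suc m')) (restValue-∷ m B H)) l)
... | inj₂ r = _ , pair-right B H m m' ,
                 cong not (trans (cong (colonValue (suc m)) (restValue-∷ m' B H)) r)
nonzero⇒zero-reachable {pos B H (just (dotColon (suc m)))} _ v = _ , dotColon-move B H m , not-flip v

open Outcome size-decreasing SmallHeaps-preserved zero⇒moves-to-nonzero nonzero⇒zero-reachable

block⇔ε-heap : ∀ m G → Win (pos (m ∷ G) [] nothing) ⇔ Win (pos G (ε m ∷ []) nothing)
block⇔ε-heap m G = mk⇔
  (λ w → from (win⇔val _ small) (trans (sym same) (to (win⇔val _ []) w)))
  (λ w → from (win⇔val _ []) (trans same (to (win⇔val _ small) w)))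
  where
  small : All (_≤ 1) (ε m ∷ [])
  small = ε≤1 m ∷ []
  same : restValue (m ∷ G) [] ≡ restValue G (ε m ∷ [])
  same = restValue-block≡heap m G

loonyResidue : ℕ → Bool
loonyResidue 1 = true
loonyResidue 4 = true
loonyResidue _ = false

loonyᵇ : ℕ → Bool
loonyᵇ m = colonValue m false ∧ colonValue m true

%5-periodic : ∀ k → (12 + k) % 5 ≡ (2 + k) % 5
%5-periodic k = trans (cong (_% 5) (+-comm 10 (2 + k))) ([m+kn]%n≡m%n (2 + k) 2 5)

loonyᵇ≡loonyResidue : ∀ m → loonyᵇ m ≡ loonyResidue (m % 5)
loonyᵇ≡loonyResidue = periodic-induction 2 10 table step
  where
  table : ∀ (i : Fin 12) → loonyᵇ (toℕ i) ≡ loonyResidue (toℕ i % 5)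
  table = from-yes (all? λ (i : Fin 12) → loonyᵇ (toℕ i) ≟ᵇ loonyResidue (toℕ i % 5))
  step : ∀ k → loonyᵇ (2 + k) ≡ loonyResidue ((2 + k) % 5) →
               loonyᵇ (12 + k) ≡ loonyResidue ((12 + k) % 5)
  step k ih = begin
    loonyᵇ (12 + k)             ≡⟨ cong₂ _∧_ (colonValue-periodic k false)
                                              (colonValue-periodic k true) ⟩
    loonyᵇ (2 + k)              ≡⟨ ih ⟩
    loonyResidue ((2 + k) % 5)  ≡⟨ cong loonyResidue (%5-periodic k) ⟨
    loonyResidue ((12 + k) % 5) ∎
    where open ≡-Reasoning

loonyResidue-true : ∀ r → loonyResidue r ≡ true → r ≡ 1 ⊎ r ≡ 4
loonyResidue-true 0 ()
loonyResidue-true 1 _ = inj₁ refl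
loonyResidue-true 2 ()
loonyResidue-true 3 ()
loonyResidue-true 4 _ = inj₂ refl
loonyResidue-true (suc (suc (suc (suc (suc _))))) ()

+[1+q*5]≡5·q+1 : ∀ q → ℤ.+ (1 + q * 5) ≡ ℤ.+ 5 ℤ.* ℤ.+ q ℤ.+ ℤ.+ 1
+[1+q*5]≡5·q+1 q = trans (cong ℤ.+_ (trans (+-comm 1 (q * 5)) (cong (_+ 1) (*-comm q 5))))
                         (cong (ℤ._+ ℤ.+ 1) (ℤ.pos-* 5 q))

+[4+q*5]≡5·[1+q]-1 : ∀ q → ℤ.+ (4 + q * 5) ≡ ℤ.+ 5 ℤ.* ℤ.+ suc q ℤ.- ℤ.+ 1
+[4+q*5]≡5·[1+q]-1 q = cong ℤ.+_ (4+q*5≡q+4*[1+q] q)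
  where
  4+q*5≡q+4*[1+q] : ∀ q → 4 + q * 5 ≡ q + 4 * suc q
  4+q*5≡q+4*[1+q] = solve-∀

+m≢5·-[1+q]+1 : ∀ {m} q → ℤ.+ m ≢ ℤ.+ 5 ℤ.* -[1+ q ] ℤ.+ ℤ.+ 1
+m≢5·-[1+q]+1 q eq with trans eq (trans (ℤ.[1+m]⊖[1+n]≡m⊖n 0 (q + 4 * suc q))
                                         (cong (0 ⊖_) (+-suc q (q + 3 * suc q))))
... | ()

m≡r+q*5⇒m%5≡r%5 : ∀ {m} r q → m ≡ r + q * 5 → m % 5 ≡ r % 5
m≡r+q*5⇒m%5≡r%5 r q eq = trans (cong (_% 5) eq) ([m+kn]%n≡m%n r q 5)

fiveKPM1⇔loonyResidue : ∀ m → FiveKPM1 m ⇔ loonyResidue (m % 5) ≡ true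
fiveKPM1⇔loonyResidue m = mk⇔ residue witness
  where
  residue : FiveKPM1 m → loonyResidue (m % 5) ≡ true
  residue (ℤ.+ q       , inj₁ eq) =
    cong loonyResidue (m≡r+q*5⇒m%5≡r%5 1 q (ℤ.+-injective (trans eq (sym (+[1+q*5]≡5·q+1 q)))))
  residue (ℤ.+ zero    , inj₂ ())
  residue (ℤ.+ (suc q) , inj₂ eq) =
    cong loonyResidue (m≡r+q*5⇒m%5≡r%5 4 q (ℤ.+-injective (trans eq (sym (+[4+q*5]≡5·[1+q]-1 q)))))
  residue (-[1+ q ]    , inj₁ eq) = contradiction eq (+m≢5·-[1+q]+1 q)
  residue (-[1+ q ]    , inj₂ ())
  division : ∀ {r} → m % 5 ≡ r → m ≡ r + (m / 5) * 5
  division eq = trans (m≡m%n+[m/n]*n m 5) (cong (_+ (m / 5) * 5) eq)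
  witness : loonyResidue (m % 5) ≡ true → FiveKPM1 m
  witness r with loonyResidue-true (m % 5) r
  ... | inj₁ r≡1 = ℤ.+ (m / 5) , inj₁ (trans (cong ℤ.+_ (division r≡1)) (+[1+q*5]≡5·q+1 (m / 5)))
  ... | inj₂ r≡4 = ℤ.+ suc (m / 5) ,
                   inj₂ (trans (cong ℤ.+_ (division r≡4)) (+[4+q*5]≡5·[1+q]-1 (m / 5)))

win-colon⇔ : ∀ m G → Win (pos G [] (mkColon m)) ⇔ colonValue m (restValue G []) ≡ true
win-colon⇔ m G =
  subst (λ b → Win (pos G [] (mkColon m)) ⇔ b ≡ true) (entValue-mkColon m _) (win⇔val _ [])

loony⇔always-winning : ∀ m → Loony m ⇔ (∀ y → colonValue m y ≡ true)
-- The remainders [] and [1] have Nim-values 0 and 1.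
loony⇔always-winning m = mk⇔
  (λ { l false → to (win-colon⇔ m []) (l [])
     ; l true  → to (win-colon⇔ m (1 ∷ [])) (l (1 ∷ [])) })
  (λ c G → from (win-colon⇔ m G) (c _))

always-winning⇔loonyResidue : ∀ m →
                              (∀ y → colonValue m y ≡ true) ⇔ loonyResidue (m % 5) ≡ true
always-winning⇔loonyResidue m = mk⇔
  (λ c → trans (sym (loonyᵇ≡loonyResidue m)) (cong₂ _∧_ (c false) (c true)))
  (λ r → let both = ∧≡true (colonValue m false) (trans (loonyᵇ≡loonyResidue m) r)
         in λ { false → proj₁ both ; true → proj₂ both })

theorem2 : ((m : ℕ) → (G : List ℕ) →
                Win (pos (m ∷ G) [] nothing) ⇔ Win (pos G (ε m ∷ []) nothing))
             × ((m : ℕ) → Loony m ⇔ FiveKPM1 m)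
theorem2 = block⇔ε-heap , loony⇔FiveKPM1
  where
  loony⇔FiveKPM1 : ∀ m → Loony m ⇔ FiveKPM1 m
  loony⇔FiveKPM1 m = ⇔.trans (loony⇔always-winning m)
                     (⇔.trans (always-winning⇔loonyResidue m) (⇔.sym (fiveKPM1⇔loonyResidue m)))
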